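{- If $\mathbf{a}$ is a pure weak composition, then $\mathcal{P}(\mathbb{D}(\mathbf{a}))$ is ranked. Moreover, a rank function is given by $rk(D)=rowsum(D)-b(\mathbb{D}(\mathbf{a}))$ for $D\in KD(\mathbb{D}(\mathbf{a}))$.
   Context: A diagram is a finite set $D$ of cells $(r,c)$ with $r,c$ positive integers; $r$ is the row (rows numbered from bottom to top starting at 1) and $c$ the column (numbered from left to right starting at 1). A Kohnert move at row $r$ applied to a diagram $D$: if row $r$ of $D$ is empty, $D$ is unchanged; otherwise let $(r,c)$ be the cell of row $r$ with the largest column index; if every position $(r',c)$ with $1\le r'<r$ belongs to $D$, then $D$ is unchanged; otherwise let $r'$ be the largest integer with $1\le r'<r$ and $(r',c)\notin D$, and the move replaces the cell $(r,c)$ by $(r',c)$. For a diagram $D_0$, $KD(D_0)$ is the set of all diagrams obtainable from $D_0$ by finite (possibly empty) sequences of Kohnert moves; the Kohnert poset $\mathcal{P}(D_0)$ is $KD(D_0)$ ordered by $D_2\preceq D_1$ iff $D_2$ can be obtained from $D_1$ by a finite sequence of Kohnert moves; $Min(D_0)$ is its set of minimal elements. $rowsum(D)=\sum_{(r,c)\in D}r$ and $b(D_0)=\min\{rowsum(T):T\in Min(D_0)\}$. A finite poset $P$ is ranked if there is a function $\rho:P\to\mathbb{Z}_{\ge0}$ such that $x\prec y$ implies $\rho(x)<\rho(y)$ and $\rho(y)=\rho(x)+1$ whenever $y$ covers $x$. For a weak composition $\mathbf{a}=(a_1,\dots,a_n)\in\mathbb{Z}_{\ge0}^n$, the key diagram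 is $\mathbb{D}(\mathbf{a})=\bigcup_{i=1}^n\{(i,j):1\le j\le a_i\}$. The weak composition $\mathbf{a}$ is pure if there are no indices $1\le j_1<j_2<j_3\le n$ with $a_{j_1}<a_{j_2}<a_{j_3}$, or $a_{j_1}<a_{j_3}<a_{j_2}$, or $a_{j_1}+1<a_{j_2}=a_{j_3}$. -}

module Defs where

open import Data.Nat using (ℕ; zero; suc; _+_; _∸_; _≤_; _<_; _⊔_)
import Data.Nat.Properties as ℕP
open import Data.Product using (_×_; _,_; proj₁; proj₂; Σ; ∃; ∃-syntax)
open import Data.Product.Properties using (≡-dec)
open import Data.Maybe using (Maybe; just; nothing)
open import Data.List using (List; []; _∷_; _++_; map; filter; deduplicate; upTo)
open import Data.Nat.ListAction using (sum)
open import Data.List.Membership.Propositional using (_∈_)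
open import Data.Vec using (Vec; lookup; toList)
open import Data.Fin using (Fin)
import Data.Fin as Fin
open import Data.Sum using (_⊎_)
open import Data.Empty using (⊥)
open import Relation.Nullary using (¬_; Dec; yes; no; ¬?)
open import Relation.Binary.PropositionalEquality using (_≡_)
open import Relation.Binary.Definitions using (DecidableEquality)
open import Function.Bundles using (_⇔_)

-- A cell is (r , c) : row r, column c (both intended to be ≥ 1).
-- A diagram is a finite set of cells, represented by a list; two lists
-- represent the same diagram iff they have the same members (_≈_).

Cell : Set
Cell = ℕ × ℕ

Diagram : Set
Diagram = List Cell

_≟ᶜ_ : DecidableEquality Cell
_≟ᶜ_ = ≡-dec ℕP._≟_ ℕP._≟_

_∈?ᶜ_ : (x : Cell) (D : Diagram) → Dec (x ∈ D)
x ∈?ᶜ D = Data.List.Membership.DecPropositional._∈?_ _≟ᶜ_ x D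
  where import Data.List.Membership.DecPropositional

_≈_ : Diagram → Diagram → Set
D ≈ E = ∀ x → (x ∈ D) ⇔ (x ∈ E)

maxCol : ℕ → Diagram → Maybe ℕ
maxCol r [] = nothing
maxCol r ((r' , c) ∷ D) with r' ℕP.≟ r | maxCol r D
... | no _  | m        = m
... | yes _ | nothing  = just c
... | yes _ | just c'  = just (c ⊔ c')

gap : ℕ → ℕ → Diagram → Maybe ℕ
gap c zero    D = nothing
gap c (suc k) D with (suc k , c) ∈?ᶜ D
... | yes _ = gap c k D
... | no  _ = just (suc k)

kohnertMove : ℕ → Diagram → Diagram
kohnertMove r D with maxCol r D
... | nothing = D
... | just c with gap c (r ∸ 1) D
...   | nothing = D
...   | just r' = (r' , c) ∷ filter (λ x → ¬? (x ≟ᶜ (r , c))) D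

data _⇝_ : Diagram → Diagram → Set where
  done : ∀ {D E} → D ≈ E → D ⇝ E
  step : ∀ {D E} (r : ℕ) → kohnertMove r D ⇝ E → D ⇝ E

InKD : Diagram → Diagram → Set
InKD D₀ D = D₀ ⇝ D

_⪯_ : Diagram → Diagram → Set
D₂ ⪯ D₁ = D₁ ⇝ D₂

_≺_ : Diagram → Diagram → Set
D₂ ≺ D₁ = D₂ ⪯ D₁ × ¬ (D₂ ≈ D₁)

Covers : Diagram → Diagram → Diagram → Set
Covers D₀ D₁ D₂ =
  D₂ ≺ D₁ × (∀ E → InKD D₀ E → D₂ ≺ E → E ≺ D₁ → ⊥)

InMin : Diagram → Diagram → Set
InMin D₀ T = InKD D₀ T × (∀ T' → InKD D₀ T' → T' ⪯ T → T' ≈ T)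

-- rowsum (duplicates removed, so it is a function of the underlying set)

rowsum : Diagram → ℕ
rowsum D = sum (map proj₁ (deduplicate _≟ᶜ_ D))

IsB : Diagram → ℕ → Set
IsB D₀ b = (∃[ T ] (InMin D₀ T × rowsum T ≡ b))
         × (∀ T → InMin D₀ T → b ≤ rowsum T)

IsRankFunction : Diagram → (Diagram → ℕ) → Set
IsRankFunction D₀ ρ =
  (∀ x y → InKD D₀ x → InKD D₀ y → x ≺ y → ρ x < ρ y)
  × (∀ x y → InKD D₀ x → InKD D₀ y → Covers D₀ y x → ρ y ≡ suc (ρ x))

Ranked : Diagram → Set
Ranked D₀ = ∃[ ρ ] IsRankFunction D₀ ρ

keyFrom : ℕ → List ℕ → Diagram
keyFrom i []       = []
keyFrom i (a ∷ as) = map (λ j → (i , suc j)) (upTo a) ++ keyFrom (suc i) as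

keyDiagram : ∀ {n} → Vec ℕ n → Diagram
keyDiagram a = keyFrom 1 (toList a)

Pure : ∀ {n} → Vec ℕ n → Set
Pure {n} a = ∀ (j₁ j₂ j₃ : Fin n) → j₁ Fin.< j₂ → j₂ Fin.< j₃ →
  ¬ ( (lookup a j₁ < lookup a j₂ × lookup a j₂ < lookup a j₃)
    ⊎ (lookup a j₁ < lookup a j₃ × lookup a j₃ < lookup a j₂)
    ⊎ (suc (lookup a j₁) < lookup a j₂ × lookup a j₂ ≡ lookup a j₃) )

{-# OPTIONS --safe #-}
module Submission where

-- A genuine Kohnert move lowers one cell, so it strictly decreases rowsum; every diagram
-- descends to one admitting no move, which is minimal, hence rowsum ≥ b on KD and
-- rowsum ∸ b is strictly monotone. For the covering relation, call a diagram tame if no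
-- column has two cells above a hole (h , c) while some cell right of column c lies above
-- row h. Pure key diagrams are tame, and Kohnert moves preserve tameness. In a tame
-- diagram a move dropping (r , c) to r' < r − 1 factors through an intermediate diagram:
-- first drop (r − 1 , c) to r' (tameness makes it rightmost in its row), then (r , c) to
-- r − 1. Hence a cover is a drop by exactly one row, which lowers rowsum by exactly one.

open import Defs
open import Data.Nat using (ℕ; zero; suc; _+_; _∸_; _⊔_; _≤_; _<_; z≤n; s≤s; s≤s⁻¹; s<s⁻¹; _≟_; _<?_; _≤?_)
open import Data.Nat.Properties
  using ( ≤-refl; ≤-trans; ≤-antisym; <-trans; <-irrefl; <-asym; <⇒≤; <⇒≢; ≰⇒>; n≮0
        ; <-≤-trans; n<1+n; n≤1+n; ≮⇒≥; m≤m⊔n; m≤n⊔m; ⊔-sel; m≤n⇒m<n∨m≡n; <-cmp; +-suc; +-identityʳ; +-comm; +-assoc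
        ; +-cancelʳ-≡; +-cancelʳ-<; +-monoʳ-<; ∸-monoˡ-<; +-∸-assoc; ≤-reflexive
        ; module ≤-Reasoning )
open import Data.Nat.Induction using (<-wellFounded)
open import Data.Nat.ListAction using (sum)
open import Data.Nat.ListAction.Properties using (sum-↭)
open import Data.Product using (_×_; _,_; proj₁; proj₂; ∃-syntax)
open import Data.Sum using (_⊎_; inj₁; inj₂)
open import Data.Empty using (⊥; ⊥-elim)
open import Data.Maybe using (Maybe; just; nothing)
open import Data.List using (List; []; _∷_; map; filter; deduplicate; upTo)
open import Data.List.Relation.Unary.Any using (here; there; any?; satisfied)
open import Data.List.Relation.Unary.All using (All; tabulate)
open import Data.List.Relation.Unary.AllPairs using (_∷_)
open import Data.List.Relation.Unary.Unique.Propositional using (Unique)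
open import Data.List.Relation.Unary.Unique.DecPropositional.Properties _≟ᶜ_ using (deduplicate-!)
open import Data.List.Relation.Binary.BagAndSetEquality using (∼bag⇒↭)
open import Data.List.Relation.Binary.Permutation.Propositional.Properties using (map⁺)
open import Data.List.Membership.Propositional using (_∈_; _∉_; lose)
open import Data.List.Membership.Propositional.Properties
  using (∈-map⁺; ∈-map⁻; ∈-filter⁺; ∈-filter⁻; ∈-deduplicate⁺; ∈-deduplicate⁻; ∈-++⁺ˡ; ∈-++⁺ʳ; ∈-++⁻; ∈-upTo⁺; ∈-upTo⁻)
open import Data.List.Membership.Propositional.Properties.WithK using (unique∧set⇒bag)
open import Data.Vec using (Vec; []; _∷_; lookup; toList)
open import Data.Fin using (fromℕ<) renaming (_<_ to _<ᶠ_)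
open import Data.Fin.Properties using (toℕ-fromℕ<)
open import Function.Base using (_∘_; _on_)
open import Function.Bundles using (mk⇔; Equivalence)
open import Function.Properties.Equivalence using () renaming (refl to ⇔-refl; sym to ⇔-sym; trans to ⇔-trans)
open import Induction.WellFounded using (Acc; acc)
open import Relation.Binary.Construct.On using (wellFounded)
open import Relation.Binary.Definitions using (tri<; tri≈; tri>)
open import Relation.Binary.PropositionalEquality using (_≡_; _≢_; refl; sym; trans; cong; subst; subst₂; module ≡-Reasoning)
open import Relation.Nullary using (¬_; yes; no; ¬?)

≈-refl : ∀ {D} → D ≈ D
≈-refl _ = ⇔-refl

≈-sym : ∀ {D E} → D ≈ E → E ≈ D
≈-sym d x = ⇔-sym (d x)

≈-trans : ∀ {D E F} → D ≈ E → E ≈ F → D ≈ F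
≈-trans d e x = ⇔-trans (d x) (e x)

≡⇒≈ : ∀ {D E} → D ≡ E → D ≈ E
≡⇒≈ refl = ≈-refl

≈⇒⊆ : ∀ {D E} → D ≈ E → ∀ {x} → x ∈ D → x ∈ E
≈⇒⊆ d = Equivalence.to (d _)

remove : Cell → Diagram → Diagram
remove x = filter (λ y → ¬? (y ≟ᶜ x))

∈-remove⁺ : ∀ {x y D} → y ∈ D → y ≢ x → y ∈ remove x D
∈-remove⁺ {x} = ∈-filter⁺ (λ y → ¬? (y ≟ᶜ x))

∈-remove⁻ : ∀ {x y} D → y ∈ remove x D → y ∈ D × y ≢ x
∈-remove⁻ {x} D = ∈-filter⁻ (λ y → ¬? (y ≟ᶜ x)) {xs = D}

moveCell : ℕ → ℕ → ℕ → Diagram → Diagram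
moveCell r c r' D = (r' , c) ∷ remove (r , c) D

∈-moveCell⁺ : ∀ {r c r' z D} → z ∈ D → z ≢ (r , c) → z ∈ moveCell r c r' D
∈-moveCell⁺ z∈ z≢ = there (∈-remove⁺ z∈ z≢)

∈-moveCell⁻ : ∀ {r c r' z} D → z ∈ moveCell r c r' D → z ≡ (r' , c) ⊎ (z ∈ D × z ≢ (r , c))
∈-moveCell⁻ D (here z≡) = inj₁ z≡
∈-moveCell⁻ D (there z∈) = inj₂ (∈-remove⁻ D z∈)

∉-moveCell⇒vacated : ∀ {r c r' z D} → z ∈ D → z ∉ moveCell r c r' D → z ≡ (r , c)
∉-moveCell⇒vacated {r} {c} {z = z} z∈ z∉ with z ≟ᶜ (r , c)
... | yes z≡ = z≡
... | no z≢ = ⊥-elim (z∉ (∈-moveCell⁺ z∈ z≢))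

moveCell-≈ : ∀ {r c r' D E} → D ≈ E → moveCell r c r' D ≈ moveCell r c r' E
moveCell-≈ {r} {c} {r'} d z = mk⇔ (transport d) (transport (≈-sym d))
  where
  transport : ∀ {D E} → D ≈ E → z ∈ moveCell r c r' D → z ∈ moveCell r c r' E
  transport {D} d z∈ with ∈-moveCell⁻ D z∈
  ... | inj₁ refl = here refl
  ... | inj₂ (z∈D , z≢) = ∈-moveCell⁺ (≈⇒⊆ d z∈D) z≢

moveCell-compose : ∀ {r m r' c D} → (m , c) ∈ D → m ≢ r → r' ≢ r →
  moveCell r c m (moveCell m c r' D) ≈ moveCell r c r' D
moveCell-compose {r} {m} {r'} {c} {D} m∈ m≢r r'≢r z = mk⇔ to from
  where
  to : z ∈ moveCell r c m (moveCell m c r' D) → z ∈ moveCell r c r' D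
  to z∈ with ∈-moveCell⁻ (moveCell m c r' D) z∈
  ... | inj₁ refl = ∈-moveCell⁺ m∈ (m≢r ∘ cong proj₁)
  ... | inj₂ (z∈′ , z≢r) with ∈-moveCell⁻ D z∈′
  ...   | inj₁ refl = here refl
  ...   | inj₂ (z∈D , _) = ∈-moveCell⁺ z∈D z≢r
  from : z ∈ moveCell r c r' D → z ∈ moveCell r c m (moveCell m c r' D)
  from z∈ with ∈-moveCell⁻ D z∈
  ... | inj₁ refl = ∈-moveCell⁺ (here refl) (r'≢r ∘ cong proj₁)
  ... | inj₂ (z∈D , z≢r) with z ≟ᶜ (m , c)
  ...   | yes refl = here refl
  ...   | no z≢m = ∈-moveCell⁺ {r} {c} {m} (∈-moveCell⁺ {m} {c} {r'} z∈D z≢m) z≢r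

rowsum-unique : ∀ {D U} → Unique U → D ≈ U → rowsum D ≡ sum (map proj₁ U)
rowsum-unique {D} u d = sum-↭ (map⁺ proj₁ (∼bag⇒↭ (unique∧set⇒bag (deduplicate-! D) u
  (mk⇔ (≈⇒⊆ d ∘ ∈-deduplicate⁻ _≟ᶜ_ D) (∈-deduplicate⁺ _≟ᶜ_ ∘ ≈⇒⊆ (≈-sym d))))))

≈-deduplicate : ∀ D → D ≈ deduplicate _≟ᶜ_ D
≈-deduplicate D x = mk⇔ (∈-deduplicate⁺ _≟ᶜ_) (∈-deduplicate⁻ _≟ᶜ_ D)

rowsum-≈ : ∀ {D E} → D ≈ E → rowsum D ≡ rowsum E
rowsum-≈ {E = E} d = rowsum-unique (deduplicate-! E) (≈-trans d (≈-deduplicate E))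

rowsum-∷ : ∀ {x L} → x ∉ L → rowsum (x ∷ L) ≡ proj₁ x + rowsum L
rowsum-∷ {x} {L} x∉ = rowsum-unique (x≢L ∷ deduplicate-! L) (λ y → mk⇔ to from)
  where
  x≢L : All (x ≢_) (deduplicate _≟ᶜ_ L)
  x≢L = tabulate (λ y∈ x≡y → x∉ (subst (_∈ L) (sym x≡y) (∈-deduplicate⁻ _≟ᶜ_ L y∈)))
  to : ∀ {y} → y ∈ x ∷ L → y ∈ x ∷ deduplicate _≟ᶜ_ L
  to (here y≡) = here y≡
  to (there y∈) = there (∈-deduplicate⁺ _≟ᶜ_ y∈)
  from : ∀ {y} → y ∈ x ∷ deduplicate _≟ᶜ_ L → y ∈ x ∷ L
  from (here y≡) = here y≡
  from (there y∈) = there (∈-deduplicate⁻ _≟ᶜ_ L y∈)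

rowsum-remove : ∀ {x D} → x ∈ D → rowsum D ≡ proj₁ x + rowsum (remove x D)
rowsum-remove {x} {D} x∈ =
  trans (rowsum-≈ D≈x∷rest) (rowsum-∷ (λ x∈rest → proj₂ (∈-remove⁻ D x∈rest) refl))
  where
  D≈x∷rest : D ≈ (x ∷ remove x D)
  D≈x∷rest y = mk⇔ to from
    where
    to : y ∈ D → y ∈ x ∷ remove x D
    to y∈ with y ≟ᶜ x
    ... | yes refl = here refl
    ... | no y≢x = there (∈-remove⁺ y∈ y≢x)
    from : y ∈ x ∷ remove x D → y ∈ D
    from (here refl) = x∈
    from (there y∈) = proj₁ (∈-remove⁻ D y∈)

rowsum-moveCell : ∀ {r c r' D} → (r , c) ∈ D → (r' , c) ∉ D →
  rowsum (moveCell r c r' D) + r ≡ rowsum D + r'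
rowsum-moveCell {r} {c} {r'} {D} cell hole = begin
  rowsum (moveCell r c r' D) + r  ≡⟨ cong (_+ r) (rowsum-∷ (hole ∘ proj₁ ∘ ∈-remove⁻ D)) ⟩
  r' + R + r                      ≡⟨ +-comm (r' + R) r ⟩
  r + (r' + R)                    ≡⟨ cong (r +_) (+-comm r' R) ⟩
  r + (R + r')                    ≡⟨ sym (+-assoc r R r') ⟩
  r + R + r'                      ≡⟨ cong (_+ r') (sym (rowsum-remove cell)) ⟩
  rowsum D + r'                   ∎
  where
  open ≡-Reasoning
  R : ℕ
  R = rowsum (remove (r , c) D)

-- Kohnert moves

data MaxColView (r : ℕ) (D : Diagram) : Maybe ℕ → Set where
  empty     : (∀ {c} → (r , c) ∉ D) → MaxColView r D nothing
  nonempty  : ∀ {c} → (r , c) ∈ D → (∀ {c'} → (r , c') ∈ D → c' ≤ c) → MaxColView r D (just c)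

maxColView : ∀ r D → MaxColView r D (maxCol r D)
maxColView r [] = empty λ ()
maxColView r ((r₀ , c₀) ∷ D) with r₀ ≟ r | maxCol r D | maxColView r D
... | no r₀≢r | _ | empty none = empty λ where
  (here refl) → r₀≢r refl
  (there c∈) → none c∈
... | no r₀≢r | _ | nonempty c∈ right = nonempty (there c∈) λ where
  (here refl) → ⊥-elim (r₀≢r refl)
  (there c'∈) → right c'∈
... | yes refl | _ | empty none = nonempty (here refl) λ where
  (here refl) → ≤-refl
  (there c'∈) → ⊥-elim (none c'∈)
... | yes refl | _ | nonempty {c} c∈ right = nonempty max∈ bounded
  where
  bounded : ∀ {c'} → (r , c') ∈ (r , c₀) ∷ D → c' ≤ c₀ ⊔ c
  bounded (here refl) = m≤m⊔n c₀ c
  bounded (there c'∈) = ≤-trans (right c'∈) (m≤n⊔m c₀ c)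
  max∈ : (r , c₀ ⊔ c) ∈ (r , c₀) ∷ D
  max∈ with ⊔-sel c₀ c
  ... | inj₁ ⊔≡c₀ rewrite ⊔≡c₀ = here refl
  ... | inj₂ ⊔≡c rewrite ⊔≡c = there c∈

data GapView (c k : ℕ) (D : Diagram) : Maybe ℕ → Set where
  no-hole : (∀ {i} → 1 ≤ i → i ≤ k → (i , c) ∈ D) → GapView c k D nothing
  highest-hole : ∀ {r'} → 1 ≤ r' → r' ≤ k → (r' , c) ∉ D →
                 (∀ {i} → r' < i → i ≤ k → (i , c) ∈ D) → GapView c k D (just r')

column-upto-suc : ∀ {c k i : ℕ} {D : Diagram} → (suc k , c) ∈ D → (i ≤ k → (i , c) ∈ D) → i ≤ suc k → (i , c) ∈ D
column-upto-suc top∈ below i≤1+k with m≤n⇒m<n∨m≡n i≤1+k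
... | inj₁ i<1+k = below (s≤s⁻¹ i<1+k)
... | inj₂ refl = top∈

gapView : ∀ c k D → GapView c k D (gap c k D)
gapView c zero D = no-hole λ 1≤i i≤0 → ⊥-elim (n≮0 (≤-trans 1≤i i≤0))
gapView c (suc k) D with (suc k , c) ∈?ᶜ D
... | no top∉ = highest-hole (s≤s z≤n) ≤-refl top∉ (λ k<i i≤k → ⊥-elim (<-irrefl refl (<-≤-trans k<i i≤k)))
... | yes top∈ with gap c k D | gapView c k D
...   | _ | no-hole full = no-hole λ 1≤i → column-upto-suc top∈ (full 1≤i)
...   | _ | highest-hole 1≤r' r'≤k hole above =
  highest-hole 1≤r' (≤-trans r'≤k (n≤1+n k)) hole λ r'<i → column-upto-suc top∈ (above r'<i)

record Drop (D : Diagram) (r c r' : ℕ) : Set where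
  field
    cell      : (r , c) ∈ D
    rightmost : ∀ {c'} → (r , c') ∈ D → c' ≤ c
    target≥1  : 1 ≤ r'
    target<   : r' < r
    hole      : (r' , c) ∉ D
    filled    : ∀ {i} → r' < i → i < r → (i , c) ∈ D

open Drop

<⇒≤∸1 : ∀ {m n} → m < n → m ≤ n ∸ 1
<⇒≤∸1 (s≤s m≤n) = m≤n

≤∸1⇒< : ∀ {m n} → 1 ≤ m → m ≤ n ∸ 1 → m < n
≤∸1⇒< {n = suc n} _ m≤n = s≤s m≤n
≤∸1⇒< {n = zero} 1≤m m≤0 = ⊥-elim (n≮0 (≤-trans 1≤m m≤0))

data KohnertView (r : ℕ) (D : Diagram) : Diagram → Set where
  stays : (∀ {c r'} → ¬ Drop D r c r') → KohnertView r D D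
  drops : ∀ {c r'} → Drop D r c r' → KohnertView r D (moveCell r c r' D)

kohnertView : ∀ r D → KohnertView r D (kohnertMove r D)
kohnertView r D with maxCol r D | maxColView r D
... | _ | empty none = stays (none ∘ cell)
... | _ | nonempty {c} c∈ right with gap c (r ∸ 1) D | gapView c (r ∸ 1) D
...   | _ | no-hole full = stays λ dr →
  hole dr (subst (λ c′ → (_ , c′) ∈ D) (≤-antisym (rightmost dr c∈) (right (cell dr)))
                 (full (target≥1 dr) (<⇒≤∸1 (target< dr))))
...   | _ | highest-hole 1≤r' r'≤ hole′ above = drops record
  { cell = c∈ ; rightmost = right ; target≥1 = 1≤r' ; target< = ≤∸1⇒< 1≤r' r'≤
  ; hole = hole′ ; filled = λ r'<i i<r → above r'<i (<⇒≤∸1 i<r) }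

Drop-unique : ∀ {D r c₁ r₁ c₂ r₂} → Drop D r c₁ r₁ → Drop D r c₂ r₂ → (c₁ , r₁) ≡ (c₂ , r₂)
Drop-unique {r₁ = r₁} {r₂ = r₂} d₁ d₂ with ≤-antisym (rightmost d₂ (cell d₁)) (rightmost d₁ (cell d₂))
... | refl with <-cmp r₁ r₂
...   | tri< r₁<r₂ _ _ = ⊥-elim (hole d₂ (filled d₁ r₁<r₂ (target< d₂)))
...   | tri≈ _ refl _ = refl
...   | tri> _ _ r₂<r₁ = ⊥-elim (hole d₁ (filled d₂ r₂<r₁ (target< d₁)))

kohnertMove-drop : ∀ {D r c r'} → Drop D r c r' → kohnertMove r D ≡ moveCell r c r' D
kohnertMove-drop {D} {r} dr with kohnertMove r D | kohnertView r D
... | _ | stays stuck = ⊥-elim (stuck dr)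
... | _ | drops dr′ with Drop-unique dr′ dr
...   | refl = refl

Drop-≈ : ∀ {D E r c r'} → D ≈ E → Drop D r c r' → Drop E r c r'
Drop-≈ d dr = record
  { cell = ≈⇒⊆ d (cell dr) ; rightmost = rightmost dr ∘ ≈⇒⊆ (≈-sym d)
  ; target≥1 = target≥1 dr ; target< = target< dr
  ; hole = hole dr ∘ ≈⇒⊆ (≈-sym d) ; filled = λ r'<i i<r → ≈⇒⊆ d (filled dr r'<i i<r) }

kohnertMove-≈ : ∀ r {D E} → D ≈ E → kohnertMove r D ≈ kohnertMove r E
kohnertMove-≈ r {D} {E} d with kohnertMove r D | kohnertView r D
... | _ | drops dr rewrite kohnertMove-drop (Drop-≈ d dr) = moveCell-≈ d
... | _ | stays stuckD with kohnertMove r E | kohnertView r E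
...   | _ | stays _ = d
...   | _ | drops dr = ⊥-elim (stuckD (Drop-≈ (≈-sym d) dr))

Drop-rowsum-< : ∀ {D r c r'} → Drop D r c r' → rowsum (moveCell r c r' D) < rowsum D
Drop-rowsum-< {D} {r} {c} {r'} dr = +-cancelʳ-< r _ _ (begin-strict
  rowsum (moveCell r c r' D) + r  ≡⟨ rowsum-moveCell (cell dr) (hole dr) ⟩
  rowsum D + r'                   <⟨ +-monoʳ-< (rowsum D) (target< dr) ⟩
  rowsum D + r                    ∎)
  where open ≤-Reasoning

Drop-by-one-rowsum : ∀ {D c r'} → Drop D (suc r') c r' → rowsum D ≡ suc (rowsum (moveCell (suc r') c r' D))
Drop-by-one-rowsum {D} {c} {r'} dr = +-cancelʳ-≡ r' _ _ (begin
  rowsum D + r'                                 ≡⟨ sym (rowsum-moveCell (cell dr) (hole dr)) ⟩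
  rowsum (moveCell (suc r') c r' D) + suc r'    ≡⟨ +-suc _ r' ⟩
  suc (rowsum (moveCell (suc r') c r' D)) + r'  ∎)
  where open ≡-Reasoning

⇝-respˡ-≈ : ∀ {D E F} → D ≈ E → E ⇝ F → D ⇝ F
⇝-respˡ-≈ d (done e) = done (≈-trans d e)
⇝-respˡ-≈ d (step r p) = step r (⇝-respˡ-≈ (kohnertMove-≈ r d) p)

⇝-respʳ-≈ : ∀ {D E F} → D ⇝ E → E ≈ F → D ⇝ F
⇝-respʳ-≈ (done d) e = done (≈-trans d e)
⇝-respʳ-≈ (step r p) e = step r (⇝-respʳ-≈ p e)

⇝-trans : ∀ {D E F} → D ⇝ E → E ⇝ F → D ⇝ F
⇝-trans (done d) q = ⇝-respˡ-≈ d q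
⇝-trans (step r p) q = step r (⇝-trans p q)

Drop-⇝ : ∀ {D r c r'} → Drop D r c r' → D ⇝ moveCell r c r' D
Drop-⇝ {r = r} dr = step r (done (≡⇒≈ (kohnertMove-drop dr)))

⇝-rowsum : ∀ {D E} → D ⇝ E → E ≈ D ⊎ rowsum E < rowsum D
⇝-rowsum (done d) = inj₁ (≈-sym d)
⇝-rowsum {D} (step r p) with kohnertMove r D | kohnertView r D | ⇝-rowsum p
... | _ | stays _ | E≈D⊎E<D = E≈D⊎E<D
... | _ | drops dr | inj₁ E≈M = inj₂ (subst (_< rowsum D) (sym (rowsum-≈ E≈M)) (Drop-rowsum-< dr))
... | _ | drops dr | inj₂ E<M = inj₂ (<-trans E<M (Drop-rowsum-< dr))

⇝-rowsum-≤ : ∀ {D E} → D ⇝ E → rowsum E ≤ rowsum D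
⇝-rowsum-≤ p with ⇝-rowsum p
... | inj₁ E≈D = ≤-reflexive (rowsum-≈ E≈D)
... | inj₂ E<D = <⇒≤ E<D

≺-rowsum : ∀ {D E} → E ≺ D → rowsum E < rowsum D
≺-rowsum (p , E≉D) with ⇝-rowsum p
... | inj₁ E≈D = ⊥-elim (E≉D E≈D)
... | inj₂ E<D = E<D

≺-by-rowsum : ∀ {D E} → D ⇝ E → rowsum E < rowsum D → E ≺ D
≺-by-rowsum p E<D = p , λ E≈D → <-irrefl (rowsum-≈ E≈D) E<D

≺-respˡ-≈ : ∀ {D E F} → E ≈ F → F ≺ D → E ≺ D
≺-respˡ-≈ e (p , F≉D) = ⇝-respʳ-≈ p (≈-sym e) , F≉D ∘ ≈-trans (≈-sym e)

Drop-≺ : ∀ {D r c r'} → Drop D r c r' → moveCell r c r' D ≺ D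
Drop-≺ dr = ≺-by-rowsum (Drop-⇝ dr) (Drop-rowsum-< dr)

⇝-firstDrop : ∀ {D E} → D ⇝ E → ¬ E ≈ D →
  ∃[ r ] ∃[ c ] ∃[ r' ] Drop D r c r' × moveCell r c r' D ⇝ E
⇝-firstDrop (done d) E≉D = ⊥-elim (E≉D (≈-sym d))
⇝-firstDrop {D} (step r p) E≉D with kohnertMove r D | kohnertView r D
... | _ | stays _ = ⇝-firstDrop p E≉D
... | _ | drops {c} {r'} dr = r , c , r' , dr , p

-- Minimal elements

Stuck : Diagram → Set
Stuck D = ∀ {r c r'} → ¬ Drop D r c r'

Stuck⇒minimal : ∀ {T T'} → Stuck T → T ⇝ T' → T' ≈ T
Stuck⇒minimal s (done e) = ≈-sym e
Stuck⇒minimal {T} s (step r p) with kohnertMove r T | kohnertView r T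
... | _ | stays _ = Stuck⇒minimal s p
... | _ | drops dr = ⊥-elim (s dr)

descend-to-stuck : ∀ D → ∃[ T ] D ⇝ T × Stuck T
descend-to-stuck D = go D (wellFounded rowsum <-wellFounded D)
  where
  go : ∀ D → Acc (_<_ on rowsum) D → ∃[ T ] D ⇝ T × Stuck T
  go D (acc smaller) with any? (λ r → rowsum (kohnertMove r D) <? rowsum D) (map proj₁ D)
  ... | yes lowering with satisfied lowering
  ...   | r , lt with go (kohnertMove r D) (smaller lt)
  ...     | T , p , stuck = T , step r p , stuck
  go D _ | no none = D , done ≈-refl , λ dr →
    none (lose (∈-map⁺ proj₁ (cell dr))
               (subst (λ M → rowsum M < rowsum D) (sym (kohnertMove-drop dr)) (Drop-rowsum-< dr)))

rowsum-bounded-below : ∀ {D₀ b} → (∀ T → InMin D₀ T → b ≤ rowsum T) →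
  ∀ {D} → InKD D₀ D → b ≤ rowsum D
rowsum-bounded-below b≤min {D} D₀⇝D with descend-to-stuck D
... | T , D⇝T , stuck = ≤-trans
  (b≤min T (⇝-trans D₀⇝D D⇝T , λ _ _ → Stuck⇒minimal stuck))
  (⇝-rowsum-≤ D⇝T)

-- Tame diagrams

Tame : Diagram → Set
Tame D = ∀ {h c p q s c'} → 1 ≤ h → (h , c) ∉ D → h < p → h < q → p ≢ q →
  (p , c) ∈ D → (q , c) ∈ D → h < s → c < c' → (s , c') ∉ D

Tame-≈ : ∀ {D E} → D ≈ E → Tame D → Tame E
Tame-≈ {D} {E} d tame 1≤h hole h<p h<q p≢q p∈ q∈ h<s c<c' s∈ =
  tame 1≤h (hole ∘ ≈⇒⊆ d) h<p h<q p≢q (from p∈) (from q∈) h<s c<c' (from s∈)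
  where
  from : ∀ {x} → x ∈ E → x ∈ D
  from = ≈⇒⊆ (≈-sym d)

Tame-drop : ∀ {D r c₀ r₀} → Tame D → Drop D r c₀ r₀ → Tame (moveCell r c₀ r₀ D)
Tame-drop {D} {r} {c₀} {r₀} tame dr {h} {c} {p} {q} {s} {c'} 1≤h hole′ h<p h<q p≢q p∈ q∈ h<s c<c' s∈
  with (h , c) ∈?ᶜ D
... | yes h∈D with ∉-moveCell⇒vacated h∈D hole′
...   | refl = tame (target≥1 dr) (hole dr) (<-trans r₀<r h<p) (<-trans r₀<r h<q) p≢q
                  (above h<p p∈) (above h<q q∈) (<-trans r₀<r h<s) c<c' s∈D
  where
  r₀<r : r₀ < r
  r₀<r = target< dr
  above : ∀ {i} → r < i → (i , c₀) ∈ moveCell r c₀ r₀ D → (i , c₀) ∈ D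
  above r<i i∈ with ∈-moveCell⁻ D i∈
  ... | inj₁ refl = ⊥-elim (<-asym r<i r₀<r)
  ... | inj₂ (i∈D , _) = i∈D
  s∈D : (s , c') ∈ D
  s∈D with ∈-moveCell⁻ D s∈
  ... | inj₁ refl = ⊥-elim (<-irrefl refl c<c')
  ... | inj₂ (s∈D , _) = s∈D
Tame-drop {D} {r} {c₀} {r₀} tame dr {h} {c} {p} {q} {s} {c'} 1≤h hole′ h<p h<q p≢q p∈ q∈ h<s c<c' s∈
  | no h∉D = origins (∈-moveCell⁻ D p∈) (∈-moveCell⁻ D q∈) (∈-moveCell⁻ D s∈)
  where
  r₀<r : r₀ < r
  r₀<r = target< dr
  distinct : ∀ {i} → (i , c₀) ≢ (r , c₀) → i ≢ r
  distinct i≢r refl = i≢r refl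
  Origin : Cell → Set
  Origin z = z ≡ (r₀ , c₀) ⊎ (z ∈ D × z ≢ (r , c₀))
  origins : Origin (p , c) → Origin (q , c) → Origin (s , c') → ⊥
  origins (inj₁ refl) _ (inj₁ refl) = <-irrefl refl c<c'
  origins _ (inj₁ refl) (inj₁ refl) = <-irrefl refl c<c'
  origins (inj₂ (p∈D , _)) (inj₂ (q∈D , _)) (inj₁ refl) =
    tame 1≤h h∉D h<p h<q p≢q p∈D q∈D (<-trans h<s r₀<r) c<c' (cell dr)
  origins (inj₁ refl) (inj₁ refl) _ = p≢q refl
  origins (inj₁ refl) (inj₂ (q∈D , q≢r)) (inj₂ (s∈D , _)) =
    tame 1≤h h∉D h<q (<-trans h<p r₀<r) (distinct q≢r) q∈D (cell dr) h<s c<c' s∈D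
  origins (inj₂ (p∈D , p≢r)) (inj₁ refl) (inj₂ (s∈D , _)) =
    tame 1≤h h∉D h<p (<-trans h<q r₀<r) (distinct p≢r) p∈D (cell dr) h<s c<c' s∈D
  origins (inj₂ (p∈D , _)) (inj₂ (q∈D , _)) (inj₂ (s∈D , _)) =
    tame 1≤h h∉D h<p h<q p≢q p∈D q∈D h<s c<c' s∈D

Tame-⇝ : ∀ {D E} → Tame D → D ⇝ E → Tame E
Tame-⇝ tame (done d) = Tame-≈ d tame
Tame-⇝ {D} tame (step r p) with kohnertMove r D | kohnertView r D
... | _ | stays _ = Tame-⇝ tame p
... | _ | drops dr = Tame-⇝ (Tame-drop tame dr) p

Drop-below : ∀ {D k c r'} → Tame D → Drop D (suc k) c r' → r' < k → Drop D k c r'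
Drop-below {D} {k} {c} {r'} tame dr r'<k = record
  { cell = k∈ ; rightmost = right ; target≥1 = target≥1 dr ; target< = r'<k ; hole = hole dr
  ; filled = λ r'<i i<k → filled dr r'<i (<-trans i<k (n<1+n k)) }
  where
  k∈ : (k , c) ∈ D
  k∈ = filled dr r'<k (n<1+n k)
  right : ∀ {c'} → (k , c') ∈ D → c' ≤ c
  right {c'} c'∈ with c' ≤? c
  ... | yes c'≤c = c'≤c
  ... | no c'≰c = ⊥-elim (tame (target≥1 dr) (hole dr) r'<k (<-trans r'<k (n<1+n k))
                               (<⇒≢ (n<1+n k)) k∈ (cell dr) r'<k (≰⇒> c'≰c) c'∈)

Drop-after-below : ∀ {D k c r'} → Drop D (suc k) c r' → r' < k → Drop (moveCell k c r' D) (suc k) c k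
Drop-after-below {D} {k} {c} {r'} dr r'<k = record
  { cell = ∈-moveCell⁺ (cell dr) (<⇒≢ (n<1+n k) ∘ sym ∘ cong proj₁)
  ; rightmost = right ; target≥1 = ≤-trans (target≥1 dr) (<⇒≤ r'<k) ; target< = n<1+n k
  ; hole = vacated ; filled = λ k<i i<1+k → ⊥-elim (<-irrefl refl (<-≤-trans k<i (s≤s⁻¹ i<1+k))) }
  where
  right : ∀ {c'} → (suc k , c') ∈ moveCell k c r' D → c' ≤ c
  right c'∈ with ∈-moveCell⁻ D c'∈
  ... | inj₁ refl = ⊥-elim (<-asym r'<k (n<1+n k))
  ... | inj₂ (c'∈D , _) = rightmost dr c'∈D
  vacated : (k , c) ∉ moveCell k c r' D
  vacated k∈ with ∈-moveCell⁻ D k∈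
  ... | inj₁ refl = <-irrefl refl r'<k
  ... | inj₂ (_ , k≢k) = k≢k refl

long-drop-factors : ∀ {D k c r'} → Tame D → Drop D (suc k) c r' → r' < k →
  ∃[ E ] moveCell (suc k) c r' D ≺ E × E ≺ D
long-drop-factors {D} {k} {c} {r'} tame dr r'<k =
  moveCell k c r' D ,
  ≺-respˡ-≈ (≈-sym (moveCell-compose (cell below) (<⇒≢ (n<1+n k)) (<⇒≢ (<-trans r'<k (n<1+n k)))))
            (Drop-≺ (Drop-after-below dr r'<k)) ,
  Drop-≺ below
  where
  below : Drop D k c r'
  below = Drop-below tame dr r'<k

covers⇒rowsum-suc : ∀ {D₀ x y} → Tame y → InKD D₀ y → Covers D₀ y x → rowsum y ≡ suc (rowsum x)
covers⇒rowsum-suc tame D₀⇝y ((y⇝x , x≉y) , nothing-between) with ⇝-firstDrop y⇝x x≉y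
... | r , c , r' , dr , M⇝x with ⇝-rowsum M⇝x
...   | inj₂ x<M =
  ⊥-elim (nothing-between _ (⇝-trans D₀⇝y (Drop-⇝ dr)) (≺-by-rowsum M⇝x x<M) (Drop-≺ dr))
...   | inj₁ x≈M with target< dr
...     | s≤s r'≤k with m≤n⇒m<n∨m≡n r'≤k
...       | inj₁ r'<k with long-drop-factors tame dr r'<k
...         | E , M≺E , E≺y =
  ⊥-elim (nothing-between E (⇝-trans D₀⇝y (proj₁ E≺y)) (≺-respˡ-≈ x≈M M≺E) E≺y)
covers⇒rowsum-suc tame D₀⇝y ((y⇝x , x≉y) , nothing-between)
  | r , c , r' , dr , M⇝x | inj₁ x≈M | s≤s r'≤k | inj₂ refl =
  trans (Drop-by-one-rowsum dr) (cong suc (sym (rowsum-≈ x≈M)))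

rowsum-rank : ∀ {D₀ b} → Tame D₀ → (∀ T → InMin D₀ T → b ≤ rowsum T) →
  IsRankFunction D₀ (λ D → rowsum D ∸ b)
rowsum-rank {D₀} {b} tame b≤min = strict , covers
  where
  strict : ∀ x y → InKD D₀ x → InKD D₀ y → x ≺ y → rowsum x ∸ b < rowsum y ∸ b
  strict x y D₀⇝x _ x≺y = ∸-monoˡ-< (≺-rowsum x≺y) (rowsum-bounded-below b≤min D₀⇝x)
  covers : ∀ x y → InKD D₀ x → InKD D₀ y → Covers D₀ y x → rowsum y ∸ b ≡ suc (rowsum x ∸ b)
  covers x y D₀⇝x D₀⇝y cov = trans
    (cong (_∸ b) (covers⇒rowsum-suc (Tame-⇝ tame D₀⇝y) D₀⇝y cov))
    (+-∸-assoc 1 (rowsum-bounded-below b≤min D₀⇝x))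

-- Pure key diagrams are tame

-- Entries of a composition padded with zeros: row suc k of keyFrom 1 L has length lookup₀ L k.
lookup₀ : List ℕ → ℕ → ℕ
lookup₀ []       _       = 0
lookup₀ (x ∷ _)  zero    = x
lookup₀ (_ ∷ xs) (suc k) = lookup₀ xs k

∈-keyFrom⁻ : ∀ s L {x y} → (x , y) ∈ keyFrom s L → ∃[ k ] x ≡ s + k × 1 ≤ y × y ≤ lookup₀ L k
∈-keyFrom⁻ s (a ∷ as) xy∈ with ∈-++⁻ (map (λ j → (s , suc j)) (upTo a)) xy∈
... | inj₁ xy∈row with ∈-map⁻ (λ j → (s , suc j)) xy∈row
...   | j , j∈ , refl = 0 , sym (+-identityʳ s) , s≤s z≤n , ∈-upTo⁻ j∈
∈-keyFrom⁻ s (a ∷ as) xy∈ | inj₂ xy∈rest with ∈-keyFrom⁻ (suc s) as xy∈rest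
... | k , x≡ , 1≤y , y≤ = suc k , trans x≡ (sym (+-suc s k)) , 1≤y , y≤

∈-keyFrom⁺ : ∀ s L k {y} → 1 ≤ y → y ≤ lookup₀ L k → (s + k , y) ∈ keyFrom s L
∈-keyFrom⁺ s [] k {suc y} _ ()
∈-keyFrom⁺ s (a ∷ as) zero {suc y} _ y<a rewrite +-identityʳ s =
  ∈-++⁺ˡ (∈-map⁺ (λ j → (s , suc j)) (∈-upTo⁺ y<a))
∈-keyFrom⁺ s (a ∷ as) (suc k) 1≤y y≤ rewrite +-suc s k =
  ∈-++⁺ʳ (map (λ j → (s , suc j)) (upTo a)) (∈-keyFrom⁺ (suc s) as k 1≤y y≤)

Pattern : ℕ → ℕ → ℕ → Set
Pattern x y z = (x < y × y < z) ⊎ (x < z × z < y) ⊎ (suc x < y × y ≡ z)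

PureSeq : (ℕ → ℕ) → Set
PureSeq A = ∀ {i j k} → i < j → j < k → ¬ Pattern (A i) (A j) (A k)

Pattern-cong : ∀ {x x' y y' z z'} → x ≡ x' → y ≡ y' → z ≡ z' → Pattern x y z → Pattern x' y' z'
Pattern-cong refl refl refl pat = pat

¬Pattern-0 : ∀ {x y} → ¬ Pattern x y 0
¬Pattern-0 (inj₁ (_ , y<0)) = n≮0 y<0
¬Pattern-0 (inj₂ (inj₁ (x<0 , _))) = n≮0 x<0
¬Pattern-0 (inj₂ (inj₂ (x+1<y , refl))) = n≮0 x+1<y

lookup₀-toList : ∀ {n} (a : Vec ℕ n) {i} (i<n : i < n) → lookup a (fromℕ< i<n) ≡ lookup₀ (toList a) i
lookup₀-toList (x ∷ xs) {zero} _ = refl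
lookup₀-toList (x ∷ xs) {suc i} (s≤s i<n) = lookup₀-toList xs i<n

lookup₀-beyond : ∀ {n} (a : Vec ℕ n) {k} → n ≤ k → lookup₀ (toList a) k ≡ 0
lookup₀-beyond [] _ = refl
lookup₀-beyond (x ∷ xs) (s≤s n≤k) = lookup₀-beyond xs n≤k

Pure⇒PureSeq : ∀ {n} (a : Vec ℕ n) → Pure a → PureSeq (lookup₀ (toList a))
Pure⇒PureSeq {n} a pure {i} {j} {k} i<j j<k pat with k <? n
... | no k≮n = ¬Pattern-0 (Pattern-cong refl refl (lookup₀-beyond a (≮⇒≥ k≮n)) pat)
... | yes k<n = pure (fromℕ< i<n) (fromℕ< j<n) (fromℕ< k<n) (ordered i<n j<n i<j) (ordered j<n k<n j<k)
  (Pattern-cong (sym (lookup₀-toList a i<n)) (sym (lookup₀-toList a j<n)) (sym (lookup₀-toList a k<n)) pat)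
  where
  j<n : j < n
  j<n = <-trans j<k k<n
  i<n : i < n
  i<n = <-trans i<j j<n
  ordered : ∀ {l m} (l<n : l < n) (m<n : m < n) → l < m → fromℕ< l<n <ᶠ fromℕ< m<n
  ordered l<n m<n = subst₂ _<_ (sym (toℕ-fromℕ< l<n)) (sym (toℕ-fromℕ< m<n))

PureSeq-twoLarger-ordered : ∀ {A} → PureSeq A → ∀ {i j k} → i < j → j < k → A i < A j → A i < A k →
  A j ≡ suc (A i) × A k ≡ suc (A i)
PureSeq-twoLarger-ordered {A} pure {i} {j} {k} i<j j<k Ai<Aj Ai<Ak with <-cmp (A j) (A k)
... | tri< Aj<Ak _ _ = ⊥-elim (pure i<j j<k (inj₁ (Ai<Aj , Aj<Ak)))
... | tri> _ _ Ak<Aj = ⊥-elim (pure i<j j<k (inj₂ (inj₁ (Ai<Ak , Ak<Aj))))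
... | tri≈ _ Aj≡Ak _ with suc (A i) <? A j
...   | yes Ai+1<Aj = ⊥-elim (pure i<j j<k (inj₂ (inj₂ (Ai+1<Aj , Aj≡Ak))))
...   | no Ai+1≮Aj = Aj≡ , trans (sym Aj≡Ak) Aj≡
  where
  Aj≡ : A j ≡ suc (A i)
  Aj≡ = ≤-antisym (≮⇒≥ Ai+1≮Aj) Ai<Aj

PureSeq-twoLarger : ∀ {A} → PureSeq A → ∀ {i j k} → i < j → i < k → j ≢ k → A i < A j → A i < A k →
  A j ≡ suc (A i)
PureSeq-twoLarger pure {i} {j} {k} i<j i<k j≢k Ai<Aj Ai<Ak with <-cmp j k
... | tri< j<k _ _ = proj₁ (PureSeq-twoLarger-ordered pure i<j j<k Ai<Aj Ai<Ak)
... | tri≈ _ j≡k _ = ⊥-elim (j≢k j≡k)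
... | tri> _ _ k<j = proj₂ (PureSeq-twoLarger-ordered pure i<k k<j Ai<Ak Ai<Aj)

Tame-key : ∀ {n} (a : Vec ℕ n) → Pure a → Tame (keyDiagram a)
Tame-key a pure {suc h} {c} {_} {_} {_} {c'} _ hole h<p h<q p≢q p∈ q∈ h<s c<c' s∈
  with ∈-keyFrom⁻ 1 (toList a) p∈ | ∈-keyFrom⁻ 1 (toList a) q∈ | ∈-keyFrom⁻ 1 (toList a) s∈
... | kp , refl , 1≤c , c≤Ap | kq , refl , _ , c≤Aq | ks , refl , _ , c'≤As =
  <-irrefl refl (begin-strict
    c           <⟨ c<c' ⟩
    c'          ≤⟨ c'≤As ⟩
    A ks        ≡⟨ As≡ ⟩
    suc (A h)   ≤⟨ Ah<c ⟩
    c           ∎)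
  where
  open ≤-Reasoning
  A : ℕ → ℕ
  A = lookup₀ (toList a)
  pureA : PureSeq A
  pureA = Pure⇒PureSeq a pure
  Ah<c : A h < c
  Ah<c = ≰⇒> (hole ∘ ∈-keyFrom⁺ 1 (toList a) h 1≤c)
  larger : ∀ {k} → c ≤ A k → A h < A k
  larger = <-≤-trans Ah<c
  As≡ : A ks ≡ suc (A h)
  As≡ with ks ≟ kp
  ... | yes refl = PureSeq-twoLarger pureA (s<s⁻¹ h<p) (s<s⁻¹ h<q) (p≢q ∘ cong suc) (larger c≤Ap) (larger c≤Aq)
  ... | no ks≢kp = PureSeq-twoLarger pureA (s<s⁻¹ h<s) (s<s⁻¹ h<p) ks≢kp
                     (larger (≤-trans (<⇒≤ c<c') c'≤As)) (larger c≤Ap)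

lemma6p17 : ∀ {n} (a : Vec ℕ n) → Pure a → (b : ℕ) → IsB (keyDiagram a) b →
    Ranked (keyDiagram a)
    × (∀ D → InKD (keyDiagram a) D → b ≤ rowsum D)
    × IsRankFunction (keyDiagram a) (λ D → rowsum D ∸ b)
lemma6p17 a pure b (_ , b≤min) = (_ , rank) , (λ _ → rowsum-bounded-below b≤min) , rank
  where
  rank : IsRankFunction (keyDiagram a) (λ D → rowsum D ∸ b)
  rank = rowsum-rank (Tame-key a pure) b≤min
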